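{- Let $m,b$ be positive integers. No deterministic first-stage algorithm for sand has robustness factor smaller than $$\overline{\rho}(m,b)=\frac{m^b}{m^b-(m-1)^b}=\frac{1}{1-\left(1-\frac1m\right)^b}.$$ That is, for every choice of bag sizes $a_1,\dots,a_b\ge 0$ with $\sum_j a_j=P$, there exist speeds $s_1,\dots,s_m$ such that every assignment of the bags to the machines has makespan at least $\overline{\rho}(m,b)\,C^*_{\max}$.
   Context: Speed-robust scheduling of sand (infinitesimally small jobs): In the first stage, the algorithm receives only positive integers $m$ (number of machines), $b$ (number of bags) and a real $P>0$ (total processing volume), and outputs non-negative reals $a_1,\dots,a_b$ (bag sizes) with $\sum_j a_j=P$. In the second stage, speeds $s_1,\dots,s_m\ge0$ (not all zero) are revealed and each bag is assigned as a whole to a machine (a speed-$0$ machine receives no bags); machine $i$ with bag set $M_i$ has completion time $(\sum_{j\in M_i}a_j)/s_i$ (or $0$ if $s_i=0$), and the makespan $C_{\max}$ is the maximum completion time. The optimal (adversary's) makespan is $C^*_{\max}=P/\sum_{i=1}^m s_i$. The algorithm is $\rho$-robust if for every $P$ and every choice of speeds there is an assignment of bags with $C_{\max}\le\rho\,C^*_{\max}$; its robustness factor is the smallest such $\rho$. -}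

module Defs where

open import Level using (0ℓ)
open import Data.Nat as ℕ using (ℕ; zero; suc)
open import Data.Fin using (Fin; zero; suc; _≟_)
open import Data.Bool using (if_then_else_)
open import Data.Product using (Σ; ∃; _×_; _,_)
open import Data.Sum using (_⊎_)
open import Relation.Nullary using (¬_; does)
open import Relation.Binary.PropositionalEquality using (_≡_)
open import Relation.Binary.Structures using (IsStrictTotalOrder)
open import Algebra.Structures using (IsCommutativeRing)

-- An axiomatisation of the real numbers: a Dedekind-complete ordered field
-- (unique up to isomorphism, so any model is ℝ).  The multiplicative inverse
-- is made total with the convention 0⁻¹ = 0.
record Reals : Set₁ where
  infixl 6 _+_
  infixl 7 _*_
  infix 4 _<_
  field
    Carrier : Set
    _+_ _*_ : Carrier → Carrier → Carrier
    -_ : Carrier → Carrier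
    _⁻¹ : Carrier → Carrier
    0# 1# : Carrier
    _<_ : Carrier → Carrier → Set
    isCommutativeRing : IsCommutativeRing _≡_ _+_ _*_ -_ 0# 1#
    0≢1 : ¬ (0# ≡ 1#)
    inverseʳ : ∀ x → ¬ (x ≡ 0#) → x * (x ⁻¹) ≡ 1#
    0⁻¹≡0 : 0# ⁻¹ ≡ 0#
    isStrictTotalOrder : IsStrictTotalOrder _≡_ _<_
    +-mono-< : ∀ {x y} z → x < y → x + z < y + z
    *-pos : ∀ {x y} → 0# < x → 0# < y → 0# < x * y
    complete : (S : Carrier → Set) → Σ Carrier S →
               Σ Carrier (λ u → ∀ x → S x → (x < u ⊎ x ≡ u)) →
               Σ Carrier (λ l → (∀ x → S x → (x < l ⊎ x ≡ l)) ×
                                (∀ u → (∀ x → S x → (x < u ⊎ x ≡ u)) → (l < u ⊎ l ≡ u)))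

module RealOps (R : Reals) where
  open Reals R public

  infix 4 _≤_
  _≤_ : Carrier → Carrier → Set
  x ≤ y = x < y ⊎ x ≡ y

  _-_ : Carrier → Carrier → Carrier
  x - y = x + (- y)

  _/_ : Carrier → Carrier → Carrier
  x / y = x * (y ⁻¹)

  fromℕ : ℕ → Carrier
  fromℕ zero = 0#
  fromℕ (suc n) = 1# + fromℕ n

  _^_ : Carrier → ℕ → Carrier
  x ^ zero = 1#
  x ^ suc n = x * (x ^ n)

  sumF : ∀ {n} → (Fin n → Carrier) → Carrier
  sumF {zero} f = 0#
  sumF {suc n} f = f zero + sumF (λ j → f (suc j))

  load : ∀ {m b} → (Fin b → Carrier) → (Fin b → Fin m) → Fin m → Carrier
  load a σ i = sumF (λ j → if does (σ j ≟ i) then a j else 0#)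

  -- completion time of machine i (0 if s i = 0, using 0⁻¹ = 0; valid
  -- assignments put no bag on a speed-0 machine anyway)
  completion : ∀ {m b} → (Fin b → Carrier) → (Fin m → Carrier) → (Fin b → Fin m) → Fin m → Carrier
  completion a s σ i = load a σ i / s i

  Cstar : ∀ {m} → Carrier → (Fin m → Carrier) → Carrier
  Cstar P s = P / sumF s

  ρbar : ℕ → ℕ → Carrier
  ρbar m b = (fromℕ m ^ b) / ((fromℕ m ^ b) - ((fromℕ m - 1#) ^ b))

-- The adversary makes machine 0 fast and the other m − 1 machines slow, all of one
-- speed x, with total speed K = ρ̄ P, so that ρ̄ C*max = 1.  If the fast speed
-- K − (m − 1) x is at most the volume of the bags of size ≥ x, every assignment
-- overloads a machine: either a bag of size ≥ x lands on a slow machine, or all of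
-- them land on the fast one.  Such an x exists whenever K ≤ ρ̄ P: if the largest bag
-- a has K ≤ m a take x = K / m; otherwise (m − 1) a < K − a, which is what keeps
-- K − a ≤ ρ̄(m, b − 1) (P − a), so recurse on the other bags with total speed K − a.
module Submission where

open import Defs
open import Data.Nat using (ℕ) renaming (_≤_ to _≤ℕ_)
open import Data.Fin using (Fin)
open import Data.Product using (Σ; ∃; _×_)
open import Relation.Binary.PropositionalEquality using (_≡_)

open import Data.Nat using (zero; suc)
open import Data.Fin using (zero; suc; punchIn; _≟_)
open import Data.Product using (_,_; proj₁; proj₂)
open import Data.Sum using (_⊎_; inj₁; inj₂)
open import Data.Empty using (⊥-elim)
open import Data.Bool using (true; false; if_then_else_)
open import Data.Maybe using (nothing)
open import Relation.Nullary using (¬_; Dec; yes; no; does)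
open import Relation.Nullary.Decidable using (dec-true)
open import Relation.Binary.PropositionalEquality using (refl; sym; trans; cong; cong₂; subst; subst₂; _≢_; module ≡-Reasoning)
open import Relation.Binary.Definitions using (tri<; tri≈; tri>)
open import Relation.Binary.Bundles using (StrictPartialOrder)
open import Relation.Binary.Structures using (IsStrictTotalOrder)
open import Algebra.Bundles using (CommutativeRing)
import Algebra.Properties.Ring as RingProperties
import Relation.Binary.Construct.StrictToNonStrict as StrictToNonStrict
import Relation.Binary.Reasoning.StrictPartialOrder as StrictReasoning
import Algebra.Solver.Ring.NaturalCoefficients as NaturalCoefficientsSolver

module OrderedFieldProperties (ℝ : Reals) where
  open RealOps ℝ

  commutativeRing : CommutativeRing _ _
  commutativeRing = record { isCommutativeRing = isCommutativeRing }

  open CommutativeRing commutativeRing public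
    using (+-assoc; +-comm; *-comm; *-assoc; +-identityˡ; +-identityʳ; *-identityʳ;
           -‿inverseˡ; -‿inverseʳ; zeroˡ; zeroʳ; distribˡ; distribʳ)
  open RingProperties (CommutativeRing.ring commutativeRing) public using () renaming (-0#≈0# to -0#≡0#)
  open RingProperties (CommutativeRing.ring commutativeRing) using (-1*x≈-x; -‿involutive)
  open NaturalCoefficientsSolver (CommutativeRing.commutativeSemiring commutativeRing) (λ _ _ → nothing) public
    using (solve; _:=_; _:+_; _:*_; con)
  open IsStrictTotalOrder isStrictTotalOrder using (compare; irrefl; _<?_) renaming (trans to <-trans)
  open StrictToNonStrict _≡_ _<_ public using (<⇒≤)
  open StrictToNonStrict _≡_ _<_ using (decidable′)

  strictPartialOrder : StrictPartialOrder _ _ _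
  strictPartialOrder = record { isStrictPartialOrder = IsStrictTotalOrder.isStrictPartialOrder isStrictTotalOrder }

  module ≤-Reasoning = StrictReasoning strictPartialOrder

  ≤-refl : ∀ {x} → x ≤ x
  ≤-refl = inj₂ refl

  ≤-trans : ∀ {x y z} → x ≤ y → y ≤ z → x ≤ z
  ≤-trans (inj₁ x<y) (inj₁ y<z) = inj₁ (<-trans x<y y<z)
  ≤-trans x≤y (inj₂ refl) = x≤y
  ≤-trans (inj₂ refl) y≤z = y≤z

  infix 4 _≤?_
  _≤?_ : ∀ x y → Dec (x ≤ y)
  _≤?_ = decidable′ compare

  <-≤-trans : ∀ {x y z} → x < y → y ≤ z → x < z
  <-≤-trans x<y (inj₁ y<z) = <-trans x<y y<z
  <-≤-trans x<y (inj₂ refl) = x<y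

  ≤-<-trans : ∀ {x y z} → x ≤ y → y < z → x < z
  ≤-<-trans (inj₁ x<y) y<z = <-trans x<y y<z
  ≤-<-trans (inj₂ refl) y<z = y<z

  ≰⇒> : ∀ {x y} → ¬ (x ≤ y) → y < x
  ≰⇒> {x} {y} x≰y with compare x y
  ... | tri< x<y _ _ = ⊥-elim (x≰y (inj₁ x<y))
  ... | tri≈ _ x≡y _ = ⊥-elim (x≰y (inj₂ x≡y))
  ... | tri> _ _ y<x = y<x

  ≮⇒≥ : ∀ {x y} → ¬ (x < y) → y ≤ x
  ≮⇒≥ {x} {y} x≮y with compare x y
  ... | tri< x<y _ _ = ⊥-elim (x≮y x<y)
  ... | tri≈ _ x≡y _ = inj₂ (sym x≡y)
  ... | tri> _ _ y<x = inj₁ y<x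

  >⇒≢ : ∀ {x y} → x < y → y ≢ x
  >⇒≢ x<y y≡x = irrefl (sym y≡x) x<y

  x+y-y≡x : ∀ x y → (x + y) - y ≡ x
  x+y-y≡x x y = trans (+-assoc x y (- y)) (trans (cong (x +_) (-‿inverseʳ y)) (+-identityʳ x))

  x-y+y≡x : ∀ x y → (x - y) + y ≡ x
  x-y+y≡x x y = trans (+-assoc x (- y) y) (trans (cong (x +_) (-‿inverseˡ y)) (+-identityʳ x))

  +-monoˡ-≤ : ∀ {x y} z → x ≤ y → x + z ≤ y + z
  +-monoˡ-≤ z (inj₁ x<y) = inj₁ (+-mono-< z x<y)
  +-monoˡ-≤ z (inj₂ refl) = ≤-refl

  +-monoʳ-≤ : ∀ {x y} z → x ≤ y → z + x ≤ z + y
  +-monoʳ-≤ {x} {y} z x≤y = subst₂ _≤_ (+-comm x z) (+-comm y z) (+-monoˡ-≤ z x≤y)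

  +-mono-≤ : ∀ {x y u v} → x ≤ y → u ≤ v → x + u ≤ y + v
  +-mono-≤ {y = y} {u} x≤y u≤v = ≤-trans (+-monoˡ-≤ u x≤y) (+-monoʳ-≤ y u≤v)

  +-cancelʳ-≤ : ∀ {x y} z → x + z ≤ y + z → x ≤ y
  +-cancelʳ-≤ {x} {y} z h = subst₂ _≤_ (x+y-y≡x x z) (x+y-y≡x y z) (+-monoˡ-≤ (- z) h)

  +-nonneg : ∀ {x y} → 0# ≤ x → 0# ≤ y → 0# ≤ x + y
  +-nonneg 0≤x 0≤y = subst (_≤ _ + _) (+-identityʳ 0#) (+-mono-≤ 0≤x 0≤y)

  x≤x+y : ∀ {x y} → 0# ≤ y → x ≤ x + y
  x≤x+y {x} {y} 0≤y = subst (_≤ x + y) (+-identityʳ x) (+-monoʳ-≤ x 0≤y)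

  x<x+y : ∀ {x y} → 0# < y → x < x + y
  x<x+y {x} {y} 0<y = subst₂ _<_ (+-identityˡ x) (+-comm y x) (+-mono-< x 0<y)

  0<y-x : ∀ {x y} → x < y → 0# < y - x
  0<y-x {x} x<y = subst (_< _) (-‿inverseʳ x) (+-mono-< (- x) x<y)

  0<1 : 0# < 1#
  0<1 with compare 0# 1#
  ... | tri< 0<1 _ _ = 0<1
  ... | tri≈ _ 0≡1 _ = ⊥-elim (0≢1 0≡1)
  ... | tri> _ _ 1<0 = ⊥-elim (irrefl refl (<-trans 1<0 (subst (0# <_) -1*-1≡1 (*-pos 0<-1 0<-1))))
    where
    0<-1 : 0# < - 1#
    0<-1 = subst₂ _<_ (-‿inverseʳ 1#) (+-identityˡ (- 1#)) (+-mono-< (- 1#) 1<0)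
    -1*-1≡1 : - 1# * - 1# ≡ 1#
    -1*-1≡1 = trans (-1*x≈-x (- 1#)) (-‿involutive 1#)

  *-monoʳ-< : ∀ {c x y} → 0# < c → x < y → c * x < c * y
  *-monoʳ-< {c} {x} {y} 0<c x<y = begin-strict
    c * x              <⟨ x<x+y (*-pos 0<c (0<y-x x<y)) ⟩
    c * x + c * (y - x) ≡⟨ distribˡ c x (y - x) ⟨
    c * (x + (y - x))   ≡⟨ cong (c *_) (trans (+-comm x (y - x)) (x-y+y≡x y x)) ⟩
    c * y               ∎
    where open ≤-Reasoning

  *-monoˡ-< : ∀ {c x y} → 0# < c → x < y → x * c < y * c
  *-monoˡ-< {c} {x} {y} 0<c x<y = subst₂ _<_ (*-comm c x) (*-comm c y) (*-monoʳ-< 0<c x<y)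

  *-monoʳ-≤ : ∀ {c x y} → 0# ≤ c → x ≤ y → c * x ≤ c * y
  *-monoʳ-≤ {x = x} {y} (inj₂ refl) _ = inj₂ (trans (zeroˡ x) (sym (zeroˡ y)))
  *-monoʳ-≤ (inj₁ 0<c) (inj₁ x<y) = inj₁ (*-monoʳ-< 0<c x<y)
  *-monoʳ-≤ (inj₁ _) (inj₂ refl) = ≤-refl

  *-monoˡ-≤ : ∀ {c x y} → 0# ≤ c → x ≤ y → x * c ≤ y * c
  *-monoˡ-≤ {c} {x} {y} 0≤c x≤y = subst₂ _≤_ (*-comm c x) (*-comm c y) (*-monoʳ-≤ 0≤c x≤y)

  *-cancelˡ-≤ : ∀ {c x y} → 0# < c → c * x ≤ c * y → x ≤ y
  *-cancelˡ-≤ {c} {x} {y} 0<c cx≤cy with compare x y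
  ... | tri< x<y _ _ = inj₁ x<y
  ... | tri≈ _ x≡y _ = inj₂ x≡y
  ... | tri> _ _ y<x = ⊥-elim (irrefl refl (≤-<-trans cx≤cy (*-monoʳ-< 0<c y<x)))

  *-nonneg : ∀ {x y} → 0# ≤ x → 0# ≤ y → 0# ≤ x * y
  *-nonneg {x} 0≤x 0≤y = subst (_≤ _) (zeroʳ x) (*-monoʳ-≤ 0≤x 0≤y)

  x*x⁻¹≡1 : ∀ {x} → 0# < x → x * x ⁻¹ ≡ 1#
  x*x⁻¹≡1 {x} 0<x = inverseʳ x (>⇒≢ 0<x)

  ⁻¹-pos : ∀ {x} → 0# < x → 0# < x ⁻¹
  ⁻¹-pos {x} 0<x with 0# <? x ⁻¹
  ... | yes 0<x⁻¹ = 0<x⁻¹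
  ... | no 0≮x⁻¹ = ⊥-elim (irrefl refl (begin-strict
    1#         ≡⟨ x*x⁻¹≡1 0<x ⟨
    x * x ⁻¹   ≤⟨ *-monoʳ-≤ (<⇒≤ 0<x) (≮⇒≥ 0≮x⁻¹) ⟩
    x * 0#     ≡⟨ zeroʳ x ⟩
    0#         <⟨ 0<1 ⟩
    1#         ∎))
    where open ≤-Reasoning

  ^-nonneg : ∀ {x} n → 0# ≤ x → 0# ≤ x ^ n
  ^-nonneg zero _ = <⇒≤ 0<1
  ^-nonneg (suc n) 0≤x = *-nonneg 0≤x (^-nonneg n 0≤x)

  ^-pos : ∀ {x} n → 0# < x → 0# < x ^ n
  ^-pos zero _ = 0<1
  ^-pos (suc n) 0<x = *-pos 0<x (^-pos n 0<x)

  ^-monoˡ-≤ : ∀ {x y} n → 0# ≤ x → x ≤ y → x ^ n ≤ y ^ n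
  ^-monoˡ-≤ zero _ _ = ≤-refl
  ^-monoˡ-≤ (suc n) 0≤x x≤y =
    ≤-trans (*-monoʳ-≤ 0≤x (^-monoˡ-≤ n 0≤x x≤y)) (*-monoˡ-≤ (^-nonneg n (≤-trans 0≤x x≤y)) x≤y)

  ^-monoˡ-< : ∀ {x y} n → 0# ≤ x → x < y → x ^ suc n < y ^ suc n
  ^-monoˡ-< n 0≤x x<y =
    ≤-<-trans (*-monoʳ-≤ 0≤x (^-monoˡ-≤ n 0≤x (<⇒≤ x<y))) (*-monoˡ-< (^-pos n (≤-<-trans 0≤x x<y)) x<y)

  fromℕ-nonneg : ∀ n → 0# ≤ fromℕ n
  fromℕ-nonneg zero = ≤-refl
  fromℕ-nonneg (suc n) = +-nonneg (<⇒≤ 0<1) (fromℕ-nonneg n)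

  1≤y/x : ∀ {x y} → 0# < x → x ≤ y → 1# ≤ y / x
  1≤y/x {x} {y} 0<x x≤y = subst (_≤ y / x) (x*x⁻¹≡1 0<x) (*-monoˡ-≤ (<⇒≤ (⁻¹-pos 0<x)) x≤y)

module Adversary (ℝ : Reals) where
  open RealOps ℝ
  open OrderedFieldProperties ℝ

  if-nonneg : ∀ {x} b → 0# ≤ x → 0# ≤ (if b then x else 0#)
  if-nonneg true 0≤x = 0≤x
  if-nonneg false _ = ≤-refl

  sumF-nonneg : ∀ {n} {f : Fin n → Carrier} → (∀ j → 0# ≤ f j) → 0# ≤ sumF f
  sumF-nonneg {zero} _ = ≤-refl
  sumF-nonneg {suc n} f≥0 = +-nonneg (f≥0 zero) (sumF-nonneg (λ j → f≥0 (suc j)))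

  sumF-punchIn : ∀ {n} (f : Fin (suc n) → Carrier) k → sumF f ≡ f k + sumF (λ j → f (punchIn k j))
  sumF-punchIn f zero = refl
  sumF-punchIn {suc n} f (suc k) = begin
    f zero + sumF (λ j → f (suc j))
      ≡⟨ cong (f zero +_) (sumF-punchIn (λ j → f (suc j)) k) ⟩
    f zero + (f (suc k) + sumF (λ j → f (suc (punchIn k j))))
      ≡⟨ solve 3 (λ a b c → a :+ (b :+ c) := b :+ (a :+ c)) refl _ _ _ ⟩
    f (suc k) + (f zero + sumF (λ j → f (suc (punchIn k j)))) ∎
    where open ≡-Reasoning

  ≤-sumF : ∀ {n} {f : Fin n → Carrier} → (∀ j → 0# ≤ f j) → ∀ k → f k ≤ sumF f
  ≤-sumF {suc n} {f} f≥0 k =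
    subst (f k ≤_) (sym (sumF-punchIn f k)) (x≤x+y (sumF-nonneg (λ j → f≥0 (punchIn k j))))

  sumF-const : ∀ n x → sumF {n} (λ _ → x) ≡ fromℕ n * x
  sumF-const zero x = sym (zeroˡ x)
  sumF-const (suc n) x = trans (cong (x +_) (sumF-const n x))
    (solve 2 (λ x c → x :+ c :* x := (con 1 :+ c) :* x) refl x (fromℕ n))

  argmax : ∀ {n} (f : Fin (suc n) → Carrier) → Σ (Fin (suc n)) λ k → ∀ j → f j ≤ f k
  argmax {zero} f = zero , λ { zero → ≤-refl }
  argmax {suc n} f with argmax (λ j → f (suc j))
  ... | k , f≤fk with f zero ≤? f (suc k)
  ...   | yes f0≤fk = suc k , λ { zero → f0≤fk ; (suc j) → f≤fk j }
  ...   | no f0≰fk = zero , λ { zero → ≤-refl ; (suc j) → <⇒≤ (≤-<-trans (f≤fk j) (≰⇒> f0≰fk)) }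

  ≤-sumF-if : ∀ {n} {A : Fin n → Set} (A? : ∀ j → Dec (A j)) {f : Fin n → Carrier} →
              (∀ j → 0# ≤ f j) → ∀ k → A k → f k ≤ sumF (λ j → if does (A? j) then f j else 0#)
  ≤-sumF-if A? {f} f≥0 k Ak = subst (_≤ _) own-summand (≤-sumF (λ j → if-nonneg (does (A? j)) (f≥0 j)) k)
    where
    own-summand : (if does (A? k) then f k else 0#) ≡ f k
    own-summand rewrite dec-true (A? k) Ak = refl

  bag≤load : ∀ {m n} (a : Fin n → Carrier) (σ : Fin n → Fin m) → (∀ j → 0# ≤ a j) →
             ∀ j → a j ≤ load a σ (σ j)
  bag≤load a σ a≥0 j = ≤-sumF-if (λ j′ → σ j′ ≟ σ j) a≥0 j refl

  bigVolume : ∀ {n} → Carrier → (Fin n → Carrier) → Carrier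
  bigVolume x a = sumF (λ j → if does (x ≤? a j) then a j else 0#)

  bigVolume-punchIn : ∀ {n x} (a : Fin (suc n) → Carrier) k → x ≤ a k →
                      bigVolume x a ≡ a k + bigVolume x (λ j → a (punchIn k j))
  bigVolume-punchIn {x = x} a k x≤ak
    rewrite sumF-punchIn (λ j → if does (x ≤? a j) then a j else 0#) k
          | dec-true (x ≤? a k) x≤ak = refl

  bigVolume≤load⊎misplaced : ∀ {m n} x (a : Fin n → Carrier) (σ : Fin n → Fin m) i → (∀ j → 0# ≤ a j) →
                             bigVolume x a ≤ load a σ i ⊎ ∃ λ j → x ≤ a j × σ j ≢ i
  bigVolume≤load⊎misplaced {n = zero} x a σ i a≥0 = inj₁ ≤-refl
  bigVolume≤load⊎misplaced {n = suc n} x a σ i a≥0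
    with bigVolume≤load⊎misplaced x (λ j → a (suc j)) (λ j → σ (suc j)) i (λ j → a≥0 (suc j))
  ... | inj₂ (j , x≤aj , σj≢i) = inj₂ (suc j , x≤aj , σj≢i)
  ... | inj₁ rest≤ with x ≤? a zero | σ zero ≟ i
  ...   | no _      | σ0≟i     = inj₁ (+-mono-≤ (if-nonneg (does σ0≟i) (a≥0 zero)) rest≤)
  ...   | yes _     | yes _    = inj₁ (+-monoʳ-≤ (a zero) rest≤)
  ...   | yes x≤a0  | no σ0≢i  = inj₂ (zero , x≤a0 , σ0≢i)

  -- F stands for the number m − 1 of slow machines, so M = m.
  module Thresholds (F : Carrier) (0≤F : 0# ≤ F) where
    M : Carrier
    M = 1# + F

    0<M : 0# < M
    0<M = <-≤-trans 0<1 (x≤x+y 0≤F)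

    M*x≡x+F*x : ∀ x → M * x ≡ x + F * x
    M*x≡x+F*x x = solve 2 (λ x f → (con 1 :+ f) :* x := x :+ f :* x) refl x F

    -- K ≤ ρ̄ S for ρ̄ = M ^ n / (M ^ n − F ^ n), with the denominator cleared.
    infix 4 _≤ρ̄[_]_
    _≤ρ̄[_]_ : Carrier → ℕ → Carrier → Set
    K ≤ρ̄[ n ] S = K * M ^ n ≤ S * M ^ n + K * F ^ n

    -- x is the speed of the slow machines against total speed K (see thresholdSpeeds).
    record Threshold {n} (a : Fin n → Carrier) (K : Carrier) : Set where
      field
        x : Carrier
        0≤x : 0# ≤ x
        M*x≤K : M * x ≤ K
        bigBag : ∃ λ j → x ≤ a j
        K≤bigVolume+F*x : K ≤ bigVolume x a + F * x

    threshold-atBag : ∀ {n} {K} (a : Fin n → Carrier) k → (∀ j → 0# ≤ a j) → 0# ≤ K → K ≤ M * a k →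
                      Threshold a K
    threshold-atBag {K = K} a k a≥0 0≤K K≤M*ak = record
      { x = x
      ; 0≤x = *-nonneg 0≤K (<⇒≤ (⁻¹-pos 0<M))
      ; M*x≤K = inj₂ M*x≡K
      ; bigBag = k , x≤ak
      ; K≤bigVolume+F*x = begin
          K                    ≡⟨ M*x≡K ⟨
          M * x                ≡⟨ M*x≡x+F*x x ⟩
          x + F * x            ≤⟨ +-monoˡ-≤ (F * x) x≤ak ⟩
          a k + F * x          ≤⟨ +-monoˡ-≤ (F * x) ak≤bigVolume ⟩
          bigVolume x a + F * x ∎
      }
      where
      open ≤-Reasoning
      x : Carrier
      x = K / M
      M*x≡K : M * x ≡ K
      M*x≡K = trans (solve 3 (λ m k i → m :* (k :* i) := k :* (m :* i)) refl M K (M ⁻¹))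
                    (trans (cong (K *_) (x*x⁻¹≡1 0<M)) (*-identityʳ K))
      x≤ak : x ≤ a k
      x≤ak = *-cancelˡ-≤ 0<M (subst (_≤ M * a k) (sym M*x≡K) K≤M*ak)
      ak≤bigVolume : a k ≤ bigVolume x a
      ak≤bigVolume = ≤-sumF-if (λ j → x ≤? a j) a≥0 k x≤ak

    threshold-addLargest : ∀ {n K} (a : Fin (suc n) → Carrier) k → 0# ≤ a k → (∀ j → a j ≤ a k) →
                           Threshold (λ j → a (punchIn k j)) K → Threshold a (K + a k)
    threshold-addLargest {K = K} a k 0≤ak a≤ak t = record
      { x = x
      ; 0≤x = 0≤x
      ; M*x≤K = ≤-trans M*x≤K (x≤x+y 0≤ak)
      ; bigBag = punchIn k j , x≤aj
      ; K≤bigVolume+F*x = begin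
          K + a k                          ≤⟨ +-monoˡ-≤ (a k) K≤bigVolume+F*x ⟩
          bigVolume x a′ + F * x + a k     ≡⟨ solve 3 (λ v w u → v :+ w :+ u := u :+ v :+ w) refl
                                                (bigVolume x a′) (F * x) (a k) ⟩
          a k + bigVolume x a′ + F * x     ≡⟨ cong (_+ F * x) (bigVolume-punchIn a k (≤-trans x≤aj (a≤ak _))) ⟨
          bigVolume x a + F * x            ∎
      }
      where
      open ≤-Reasoning
      open Threshold t
      a′ : Fin _ → Carrier
      a′ j = a (punchIn k j)
      j : Fin _
      j = proj₁ bigBag
      x≤aj : x ≤ a′ j
      x≤aj = proj₂ bigBag

    ≤ρ̄[1]⇒≤M* : ∀ {K S} → K ≤ρ̄[ 1 ] S → K ≤ M * S
    ≤ρ̄[1]⇒≤M* {K} {S} K≤ρ̄S = +-cancelʳ-≤ (K * (F * 1#)) (subst₂ _≤_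
      (solve 2 (λ k f → k :* ((con 1 :+ f) :* con 1) := k :+ k :* (f :* con 1)) refl K F)
      (solve 3 (λ s k f → s :* ((con 1 :+ f) :* con 1) :+ k :* (f :* con 1)
                        := (con 1 :+ f) :* s :+ k :* (f :* con 1)) refl S K F)
      K≤ρ̄S)

    ≤ρ̄-removeBag : ∀ {n K v S} → v * F ≤ K → K + v ≤ρ̄[ suc n ] v + S → K ≤ρ̄[ n ] S
    ≤ρ̄-removeBag {n} {K} {v} {S} v*F≤K K+v≤ρ̄v+S = *-cancelˡ-≤ 0<M (begin
      M * (K * A)
        ≡⟨ solve 3 (λ k f a → (con 1 :+ f) :* (k :* a) := k :* ((con 1 :+ f) :* a)) refl K F A ⟩
      K * (M * A)
        ≤⟨ +-cancelʳ-≤ (v * (M * A)) (subst₂ _≤_ lhs rhs K+v≤ρ̄v+S) ⟩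
      S * (M * A) + (K + v) * (F * B)
        ≡⟨ solve 7 (λ s m a k v f b → s :* (m :* a) :+ (k :+ v) :* (f :* b)
                                     := s :* (m :* a) :+ (k :* (f :* b) :+ (v :* f) :* b)) refl S M A K v F B ⟩
      S * (M * A) + (K * (F * B) + (v * F) * B)
        ≤⟨ +-monoʳ-≤ (S * (M * A)) (+-monoʳ-≤ (K * (F * B)) (*-monoˡ-≤ (^-nonneg n 0≤F) v*F≤K)) ⟩
      S * (M * A) + (K * (F * B) + K * B)
        ≡⟨ solve 5 (λ s f a k b → s :* ((con 1 :+ f) :* a) :+ (k :* (f :* b) :+ k :* b)
                                 := (con 1 :+ f) :* (s :* a :+ k :* b)) refl S F A K B ⟩
      M * (S * A + K * B) ∎)
      where
      open ≤-Reasoning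
      A B : Carrier
      A = M ^ n
      B = F ^ n
      lhs : (K + v) * (M * A) ≡ K * (M * A) + v * (M * A)
      lhs = distribʳ (M * A) K v
      rhs : (v + S) * (M * A) + (K + v) * (F * B) ≡ S * (M * A) + (K + v) * (F * B) + v * (M * A)
      rhs = solve 4 (λ v s ma kfb → (v :+ s) :* ma :+ kfb := s :* ma :+ kfb :+ v :* ma)
                    refl v S (M * A) ((K + v) * (F * B))

    threshold : ∀ n {K} (a : Fin (suc n) → Carrier) → (∀ j → 0# ≤ a j) → 0# ≤ K →
                K ≤ρ̄[ suc n ] sumF a → Threshold a K
    threshold zero {K} a a≥0 0≤K K≤ρ̄S =
      threshold-atBag a zero a≥0 0≤K (subst (λ S → K ≤ M * S) (+-identityʳ (a zero)) (≤ρ̄[1]⇒≤M* K≤ρ̄S))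
    threshold (suc n) {K} a a≥0 0≤K K≤ρ̄S with argmax a
    ... | k , a≤ak with K ≤? M * a k
    ...   | yes K≤M*ak = threshold-atBag a k a≥0 0≤K K≤M*ak
    ...   | no K≰M*ak = subst (Threshold a) K′+ak≡K
              (threshold-addLargest a k (a≥0 k) a≤ak
                (threshold n (λ j → a (punchIn k j)) (λ j → a≥0 (punchIn k j)) 0≤K′ K′≤ρ̄S′))
      where
      K′ : Carrier
      K′ = K - a k
      K′+ak≡K : K′ + a k ≡ K
      K′+ak≡K = x-y+y≡x K (a k)
      ak*F≤K′ : a k * F ≤ K′
      ak*F≤K′ = +-cancelʳ-≤ (a k) (subst₂ _≤_
        (solve 2 (λ v f → (con 1 :+ f) :* v := v :* f :+ v) refl (a k) F) (sym K′+ak≡K)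
        (<⇒≤ (≰⇒> K≰M*ak)))
      0≤K′ : 0# ≤ K′
      0≤K′ = ≤-trans (*-nonneg (a≥0 k) 0≤F) ak*F≤K′
      K′≤ρ̄S′ : K′ ≤ρ̄[ suc n ] sumF (λ j → a (punchIn k j))
      K′≤ρ̄S′ = ≤ρ̄-removeBag {suc n} ak*F≤K′
        (subst₂ (λ K S → K ≤ρ̄[ suc (suc n) ] S) (sym K′+ak≡K) (sumF-punchIn a k) K≤ρ̄S)

    ρ̄ : ℕ → Carrier
    ρ̄ n = (M ^ n) / ((M ^ n) - (F ^ n))

    0<M^n-F^n : ∀ n → 0# < (M ^ suc n) - (F ^ suc n)
    0<M^n-F^n n = 0<y-x (^-monoˡ-< n 0≤F (subst (F <_) (+-comm F 1#) (x<x+y 0<1)))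

    0<ρ̄ : ∀ n → 0# < ρ̄ (suc n)
    0<ρ̄ n = *-pos (^-pos (suc n) 0<M) (⁻¹-pos (0<M^n-F^n n))

    ρ̄*S≤ρ̄S : ∀ n S → ρ̄ (suc n) * S ≤ρ̄[ suc n ] S
    ρ̄*S≤ρ̄S n S = inj₂ (begin
      ρ̄S * A              ≡⟨ cong (ρ̄S *_) (x-y+y≡x A B) ⟨
      ρ̄S * (D + B)        ≡⟨ distribˡ ρ̄S D B ⟩
      ρ̄S * D + ρ̄S * B     ≡⟨ cong (_+ ρ̄S * B) ρ̄S*D≡S*A ⟩
      S * A + ρ̄S * B      ∎)
      where
      open ≡-Reasoning
      A B D ρ̄S : Carrier
      A = M ^ suc n
      B = F ^ suc n
      D = A - B
      ρ̄S = ρ̄ (suc n) * S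
      ρ̄S*D≡S*A : ρ̄S * D ≡ S * A
      ρ̄S*D≡S*A = begin
        A * D ⁻¹ * S * D       ≡⟨ solve 4 (λ a i s d → a :* i :* s :* d := s :* a :* (d :* i)) refl A (D ⁻¹) S D ⟩
        S * A * (D * D ⁻¹)     ≡⟨ cong (S * A *_) (x*x⁻¹≡1 (0<M^n-F^n n)) ⟩
        S * A * 1#             ≡⟨ *-identityʳ (S * A) ⟩
        S * A                  ∎

  fastSlow : ∀ {k} → Carrier → Carrier → Fin (suc k) → Carrier
  fastSlow y x zero = y
  fastSlow y x (suc _) = x

  module SlowMachines (k : ℕ) where
    F : Carrier
    F = fromℕ k

    open Thresholds F (fromℕ-nonneg k) public

    ρbar≡ρ̄ : ∀ n → ρbar (suc k) n ≡ ρ̄ n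
    ρbar≡ρ̄ n = cong (λ F′ → (M ^ n) / ((M ^ n) - (F′ ^ n))) (trans (cong (_- 1#) (+-comm 1# F)) (x+y-y≡x F 1#))

    ρbar*Cstar≡1 : ∀ n {P} (s : Fin (suc k) → Carrier) → 0# < P → sumF s ≡ ρ̄ (suc n) * P →
                   ρbar (suc k) (suc n) * Cstar P s ≡ 1#
    ρbar*Cstar≡1 n {P} s 0<P Σs≡ρ̄P = begin
      ρbar (suc k) (suc n) * (P / sumF s)   ≡⟨ cong₂ (λ r S → r * (P / S)) (ρbar≡ρ̄ (suc n)) Σs≡ρ̄P ⟩
      ρ̄ (suc n) * (P * K ⁻¹)               ≡⟨ *-assoc (ρ̄ (suc n)) P (K ⁻¹) ⟨
      K * K ⁻¹                             ≡⟨ x*x⁻¹≡1 (*-pos (0<ρ̄ n) 0<P) ⟩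
      1#                                   ∎
      where
      open ≡-Reasoning
      K : Carrier
      K = ρ̄ (suc n) * P

    module _ {n} {a : Fin n → Carrier} {K} (t : Threshold a K) where
      open Threshold t

      thresholdSpeeds : Fin (suc k) → Carrier
      thresholdSpeeds = fastSlow (K - (F * x)) x

      x≤fast : x ≤ K - (F * x)
      x≤fast = +-cancelʳ-≤ (F * x)
        (subst₂ _≤_ (M*x≡x+F*x x) (sym (x-y+y≡x K (F * x))) M*x≤K)

      thresholdSpeeds-nonneg : ∀ i → 0# ≤ thresholdSpeeds i
      thresholdSpeeds-nonneg zero = ≤-trans 0≤x x≤fast
      thresholdSpeeds-nonneg (suc _) = 0≤x

      thresholdSpeeds-fastPos : 0# < K → 0# < thresholdSpeeds zero
      thresholdSpeeds-fastPos 0<K with 0≤x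
      ... | inj₁ 0<x = <-≤-trans 0<x x≤fast
      ... | inj₂ 0≡x = subst (0# <_) K≡fast 0<K
        where
        K≡fast : K ≡ K - (F * x)
        K≡fast = begin
          K                 ≡⟨ +-identityʳ K ⟨
          K + 0#            ≡⟨ cong (K +_) (trans (sym -0#≡0#) (cong -_ (trans (sym (zeroʳ F)) (cong (F *_) 0≡x)))) ⟩
          K - (F * x)       ∎
          where open ≡-Reasoning

      sumF-thresholdSpeeds : sumF thresholdSpeeds ≡ K
      sumF-thresholdSpeeds = trans (cong (K - (F * x) +_) (sumF-const k x)) (x-y+y≡x K (F * x))

      thresholdSpeeds-overloaded : (∀ j → 0# ≤ a j) → 0# < K → (σ : Fin n → Fin (suc k)) →
                                   (∀ j → 0# < thresholdSpeeds (σ j)) →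
                                   ∃ λ i → 0# < thresholdSpeeds i × thresholdSpeeds i ≤ load a σ i
      thresholdSpeeds-overloaded a≥0 0<K σ σ-ok with bigVolume≤load⊎misplaced x a σ zero a≥0
      ... | inj₁ big≤load = zero , thresholdSpeeds-fastPos 0<K , ≤-trans fast≤big big≤load
        where
        fast≤big : K - (F * x) ≤ bigVolume x a
        fast≤big = +-cancelʳ-≤ (F * x) (subst (_≤ _) (sym (x-y+y≡x K (F * x))) K≤bigVolume+F*x)
      ... | inj₂ (j , x≤aj , σj≢0) = σ j , σ-ok j , ≤-trans slow≤aj (bag≤load a σ a≥0 j)
        where
        slow≤aj : thresholdSpeeds (σ j) ≤ a j
        slow≤aj with σ j
        ... | zero = ⊥-elim (σj≢0 refl)
        ... | suc _ = x≤aj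

theorem4 : (R : Reals) → let open RealOps R in
    (m b : ℕ) → 1 ≤ℕ m → 1 ≤ℕ b →
    (P : Carrier) → 0# < P →
    (a : Fin b → Carrier) → (∀ j → 0# ≤ a j) → sumF a ≡ P →
    Σ (Fin m → Carrier) (λ s →
      (∀ i → 0# ≤ s i) × (∃ λ i → 0# < s i) ×
      ((σ : Fin b → Fin m) → (∀ j → 0# < s (σ j)) →
        ∃ λ i → ρbar m b * Cstar P s ≤ completion a s σ i))
theorem4 ℝ (suc k) (suc n) _ _ P 0<P a a≥0 ΣaP =
  thresholdSpeeds t , thresholdSpeeds-nonneg t , (zero , thresholdSpeeds-fastPos t 0<K) , makespan≥ρbar
  where
  open RealOps ℝ
  open OrderedFieldProperties ℝ
  open Adversary ℝ
  open SlowMachines k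
  K : Carrier
  K = ρ̄ (suc n) * P
  0<K : 0# < K
  0<K = *-pos (0<ρ̄ n) 0<P
  t : Threshold a K
  t = threshold n a a≥0 (<⇒≤ 0<K) (subst (K ≤ρ̄[ suc n ]_) (sym ΣaP) (ρ̄*S≤ρ̄S n P))
  makespan≥ρbar : ∀ σ → (∀ j → 0# < thresholdSpeeds t (σ j)) →
                  ∃ λ i → ρbar (suc k) (suc n) * Cstar P (thresholdSpeeds t) ≤ completion a (thresholdSpeeds t) σ i
  makespan≥ρbar σ σ-ok =
    let i , 0<sᵢ , sᵢ≤load = thresholdSpeeds-overloaded t a≥0 0<K σ σ-ok
    in i , subst (_≤ completion a (thresholdSpeeds t) σ i)
                 (sym (ρbar*Cstar≡1 n (thresholdSpeeds t) 0<P (sumF-thresholdSpeeds t)))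
                 (1≤y/x 0<sᵢ sᵢ≤load)
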